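{- For every odd integer $n \geq 9$, the anti-hole $\overline{C}_n$ (the complement of the cycle on $n$ vertices) is simple kernel-solvable but not kernel-solvable.
   Context: An orientation of an undirected graph $G$ is a digraph obtained by replacing each edge $uv$ by the arc $(u,v)$, the arc $(v,u)$, or both (in which case the arcs are called reversible); it is simple if no edge receives both arcs. An orientation is clique-acyclic if every clique $Q$ of $G$ contains a vertex $q$ such that every other vertex of $Q$ has an arc to $q$. A kernel of a digraph is an independent set $S$ of vertices such that every vertex outside $S$ has an outneighbor in $S$. A graph is kernel-solvable if every clique-acyclic orientation of it has a kernel, and simple kernel-solvable if every simple clique-acyclic orientation of it has a kernel. -}

module Defs where

open import Data.Nat using (ℕ; zero; suc; _+_; _*_; _≤_)
open import Data.Fin using (Fin; toℕ)
open import Data.Bool using (Bool; true; false)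
open import Data.Product using (Σ; ∃; _×_; _,_)
open import Data.Sum using (_⊎_)
open import Relation.Nullary using (¬_)
open import Relation.Binary.PropositionalEquality using (_≡_; _≢_)

record Graph (n : ℕ) : Set₁ where
  field
    Adj   : Fin n → Fin n → Set
    sym   : ∀ {u v} → Adj u v → Adj v u
    irrefl : ∀ {u} → ¬ Adj u u
open Graph public

Digraph : ℕ → Set
Digraph n = Fin n → Fin n → Bool

VSet : ℕ → Set
VSet n = Fin n → Bool

IsOrientation : ∀ {n} → Graph n → Digraph n → Set
IsOrientation {n} G D =
  (∀ (u v : Fin n) → D u v ≡ true → Adj G u v) ×
  (∀ (u v : Fin n) → Adj G u v → (D u v ≡ true) ⊎ (D v u ≡ true))

IsSimple : ∀ {n} → Digraph n → Set
IsSimple {n} D = ∀ (u v : Fin n) → D u v ≡ true → D v u ≡ false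

IsClique : ∀ {n} → Graph n → VSet n → Set
IsClique {n} G Q =
  (∃ λ (q : Fin n) → Q q ≡ true) ×
  (∀ (u v : Fin n) → Q u ≡ true → Q v ≡ true → u ≢ v → Adj G u v)

IsCliqueAcyclic : ∀ {n} → Graph n → Digraph n → Set
IsCliqueAcyclic {n} G D =
  ∀ (Q : VSet n) → IsClique G Q →
    ∃ λ (q : Fin n) → (Q q ≡ true) ×
      (∀ (v : Fin n) → Q v ≡ true → v ≢ q → D v q ≡ true)

IsKernel : ∀ {n} → Graph n → Digraph n → VSet n → Set
IsKernel {n} G D S =
  (∀ (u v : Fin n) → S u ≡ true → S v ≡ true → ¬ Adj G u v) ×
  (∀ (u : Fin n) → S u ≡ false → ∃ λ (v : Fin n) → (S v ≡ true) × (D u v ≡ true))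

HasKernel : ∀ {n} → Graph n → Digraph n → Set
HasKernel {n} G D = ∃ λ (S : VSet n) → IsKernel G D S

KernelSolvable : ∀ {n} → Graph n → Set
KernelSolvable {n} G =
  ∀ (D : Digraph n) → IsOrientation G D → IsCliqueAcyclic G D → HasKernel G D

SimpleKernelSolvable : ∀ {n} → Graph n → Set
SimpleKernelSolvable {n} G =
  ∀ (D : Digraph n) → IsOrientation G D → IsSimple D → IsCliqueAcyclic G D →
    HasKernel G D

CycAdj : (n : ℕ) → Fin n → Fin n → Set
CycAdj n u v =
  (suc (toℕ u) ≡ toℕ v) ⊎ (suc (toℕ v) ≡ toℕ u) ⊎
  ((toℕ u ≡ 0) × (suc (toℕ v) ≡ n)) ⊎ ((toℕ v ≡ 0) × (suc (toℕ u) ≡ n))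

AntiHoleAdj : (n : ℕ) → Fin n → Fin n → Set
AntiHoleAdj n u v = (u ≢ v) × ¬ CycAdj n u v

antiHole : (n : ℕ) → Graph n
antiHole n = record { Adj = AntiHoleAdj n ; sym = s ; irrefl = i }
  where
    open import Relation.Binary.PropositionalEquality using (refl)
    import Relation.Binary.PropositionalEquality as Eq
    open import Data.Sum using (inj₁; inj₂)
    flip : ∀ {u v} → CycAdj n u v → CycAdj n v u
    flip (inj₁ p) = inj₂ (inj₁ p)
    flip (inj₂ (inj₁ p)) = inj₁ p
    flip (inj₂ (inj₂ (inj₁ p))) = inj₂ (inj₂ (inj₂ p))
    flip (inj₂ (inj₂ (inj₂ p))) = inj₂ (inj₂ (inj₁ p))
    s : ∀ {u v} → AntiHoleAdj n u v → AntiHoleAdj n v u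
    s (ne , nc) = (λ e → ne (Eq.sym e)) , (λ c → nc (flip c))
    i : ∀ {u} → ¬ AntiHoleAdj n u u
    i (ne , _) = ne refl

module Submission where

-- In a simple clique-acyclic orientation every triangle is transitive, so an arc v → u
-- hands over to u every in-neighbour of v adjacent to u; in the anti-hole only the two
-- cycle neighbours of u can be lost.  Hence, near a vertex of maximum in-degree, two
-- consecutive (so non-adjacent) vertices of the cycle form a kernel unless the arcs
-- continue to point two steps forward; walking around the odd cycle this way would
-- produce all arcs y → y + 2, which is impossible.  For the converse, orienting each edge
-- {x, x + 2} as x → x + 2 and all other edges both ways is clique-acyclic but kernel-free.

open import Data.Bool using (Bool; true; false; _∨_; if_then_else_)
open import Data.Bool.Properties using (∨-zeroʳ)
open import Data.Empty using (⊥; ⊥-elim)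
open import Data.Fin using (Fin; zero; suc; toℕ; fromℕ<)
open import Data.Fin.Properties using (_≟_; toℕ-injective; toℕ-fromℕ<; toℕ<n)
open import Data.List using (List; []; _∷_; length; allFin)
open import Data.List.Extrema.Nat using (argmax; f[xs]≤f[argmax])
open import Data.List.Membership.Propositional using (_∈_; _∉_)
open import Data.List.Membership.Propositional.Properties using (∈-allFin)
open import Data.List.Relation.Unary.All as All using (All; []; _∷_)
open import Data.List.Relation.Unary.All.Properties using (All¬⇒¬Any)
open import Data.List.Relation.Unary.AllPairs using ([]; _∷_)
open import Data.List.Relation.Unary.Any using (here; there)
open import Data.List.Relation.Unary.Unique.Propositional using (Unique)
open import Data.Nat using (ℕ; zero; suc; _+_; _*_; _∸_; _≤_; _<_; z≤n; s≤s; _%_; _/_)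
open import Data.Nat.DivMod using (m%n<n; m<n⇒m%n≡m; m≡m%n+[m/n]*n; %-distribˡ-+; m%n%n≡m%n; [m+n]%n≡m%n; n%n≡0)
open import Data.Nat.Properties
  using ( ≤-refl; ≤-reflexive; ≤-trans; ≤-<-trans; <⇒≤; <-irrefl; ≤⇒≯; n≤1+n; 1+n≰n; m≤m+n; m≤n+m
        ; m∸n≤m; m<n⇒0<n∸m; m+[n∸m]≡n; m∸n+n≡m; m+n≤o⇒n≤o; m≤n⇒m<n∨m≡n; m<1+n⇒m<n∨m≡n
        ; +-mono-≤; +-monoʳ-≤; +-monoˡ-≤; +-cancelˡ-≤; +-cancelʳ-≤; +-cancelˡ-≡; *-monoˡ-≤; *-monoʳ-≤
        ; +-comm; +-assoc; +-suc; *-comm; *-zeroʳ; *-distribˡ-+; +-commutativeSemigroup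
        ; module ≤-Reasoning )
open import Algebra.Properties.CommutativeSemigroup +-commutativeSemigroup using (interchange)
open import Data.Product using (∃; _×_; _,_; proj₁; proj₂)
open import Data.Sum using (_⊎_; inj₁; inj₂; [_,_]′)
open import Function using (_∘_)
open import Relation.Nullary using (¬_; Dec; yes; no; does; contradiction)
open import Relation.Nullary.Decidable using (dec-true; dec-false; _×-dec_; _⊎-dec_; ¬?)
open import Relation.Binary.PropositionalEquality
  using (_≡_; _≢_; refl; sym; trans; cong; subst; subst₂; module ≡-Reasoning)

open import Defs hiding (sym)

contradictionᵇ : ∀ {A : Set} {b : Bool} → b ≡ true → b ≡ false → A
contradictionᵇ refl ()

does-true : ∀ {A : Set} (a? : Dec A) → does a? ≡ true → A
does-true (yes a) _ = a

bit : Bool → ℕ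
bit b = if b then 1 else 0

count : ∀ {n} → VSet n → ℕ
count {zero}  p = 0
count {suc n} p = bit (p zero) + count (p ∘ suc)

infix 4 _⊆_
infixr 6 _∪_

_⊆_ : ∀ {n} → VSet n → VSet n → Set
p ⊆ q = ∀ x → p x ≡ true → q x ≡ true

_∪_ : ∀ {n} → VSet n → VSet n → VSet n
(p ∪ q) x = p x ∨ q x

Disjoint : ∀ {n} → VSet n → VSet n → Set
Disjoint p q = ∀ x → p x ≡ true → q x ≡ false

p⊆p∪q : ∀ {n} {p q : VSet n} → p ⊆ p ∪ q
p⊆p∪q {q = q} x px = cong (_∨ q x) px

∪-lub : ∀ {n} {p q r : VSet n} → p ⊆ r → q ⊆ r → p ∪ q ⊆ r
∪-lub {p = p} p⊆r q⊆r x h with p x in px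
... | true  = p⊆r x px
... | false = q⊆r x h

bit-mono : ∀ {a b} → (a ≡ true → b ≡ true) → bit a ≤ bit b
bit-mono {false} _ = z≤n
bit-mono {true}  h rewrite h refl = ≤-refl

bit-∨ : ∀ a b → bit (a ∨ b) ≤ bit a + bit b
bit-∨ false b = ≤-refl
bit-∨ true  b = s≤s z≤n

bit-∨-disjoint : ∀ a b → (a ≡ true → b ≡ false) → bit a + bit b ≤ bit (a ∨ b)
bit-∨-disjoint false b     _ = ≤-refl
bit-∨-disjoint true  false _ = ≤-refl
bit-∨-disjoint true  true  h = contradictionᵇ refl (h refl)

count-mono : ∀ {n} {p q : VSet n} → p ⊆ q → count p ≤ count q
count-mono {zero}  _   = z≤n
count-mono {suc n} p⊆q = +-mono-≤ (bit-mono (p⊆q zero)) (count-mono (p⊆q ∘ suc))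

count-∪ : ∀ {n} (p q : VSet n) → count (p ∪ q) ≤ count p + count q
count-∪ {zero}  p q = z≤n
count-∪ {suc n} p q = ≤-trans
  (+-mono-≤ (bit-∨ (p zero) (q zero)) (count-∪ (p ∘ suc) (q ∘ suc)))
  (≤-reflexive (interchange (bit (p zero)) (bit (q zero)) (count (p ∘ suc)) (count (q ∘ suc))))

count-∪-disjoint : ∀ {n} (p q : VSet n) → Disjoint p q → count p + count q ≤ count (p ∪ q)
count-∪-disjoint {zero}  p q _    = z≤n
count-∪-disjoint {suc n} p q disj = ≤-trans
  (≤-reflexive (interchange (bit (p zero)) (count (p ∘ suc)) (bit (q zero)) (count (q ∘ suc))))
  (+-mono-≤ (bit-∨-disjoint (p zero) (q zero) (disj zero)) (count-∪-disjoint (p ∘ suc) (q ∘ suc) (disj ∘ suc)))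

count-∅ : ∀ n → count {n} (λ _ → false) ≡ 0
count-∅ zero    = refl
count-∅ (suc n) = count-∅ n

⁅_⁆ : ∀ {n} → Fin n → VSet n
⁅ y ⁆ x = does (x ≟ y)

count-⁅⁆ : ∀ {n} (y : Fin n) → count ⁅ y ⁆ ≡ 1
count-⁅⁆ {suc n} zero    = cong suc (count-∅ n)
count-⁅⁆ {suc n} (suc y) = count-⁅⁆ y

⟦_⟧ : ∀ {n} → List (Fin n) → VSet n
⟦ [] ⟧     = λ _ → false
⟦ y ∷ ys ⟧ = ⁅ y ⁆ ∪ ⟦ ys ⟧

∈⇒∈⟦⟧ : ∀ {n} {x : Fin n} ys → x ∈ ys → ⟦ ys ⟧ x ≡ true
∈⇒∈⟦⟧ {x = x} _        (here refl)  rewrite dec-true (x ≟ x) refl = refl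
∈⇒∈⟦⟧ {x = x} (y ∷ ys) (there x∈ys) rewrite ∈⇒∈⟦⟧ ys x∈ys = ∨-zeroʳ (does (x ≟ y))

∈⟦⟧⇒∈ : ∀ {n} {x : Fin n} ys → ⟦ ys ⟧ x ≡ true → x ∈ ys
∈⟦⟧⇒∈ {x = x} (y ∷ ys) h with x ≟ y
... | yes refl = here refl
... | no _     = there (∈⟦⟧⇒∈ ys h)

∉⇒∉⟦⟧ : ∀ {n} {x : Fin n} {ys} → x ∉ ys → ⟦ ys ⟧ x ≡ false
∉⇒∉⟦⟧ {x = x} {ys} x∉ys with ⟦ ys ⟧ x in e
... | true  = contradiction (∈⟦⟧⇒∈ ys e) x∉ys
... | false = refl

count-⟦⟧ : ∀ {n} (ys : List (Fin n)) → count ⟦ ys ⟧ ≤ length ys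
count-⟦⟧ {n} []   = ≤-reflexive (count-∅ n)
count-⟦⟧ (y ∷ ys) =
  ≤-trans (count-∪ ⁅ y ⁆ ⟦ ys ⟧) (+-mono-≤ (≤-reflexive (count-⁅⁆ y)) (count-⟦⟧ ys))

count-⟦⟧-unique : ∀ {n} {ys : List (Fin n)} → Unique ys → length ys ≤ count ⟦ ys ⟧
count-⟦⟧-unique []                      = z≤n
count-⟦⟧-unique {ys = y ∷ ys} (y∉ ∷ u) = ≤-trans
  (+-mono-≤ (≤-reflexive (sym (count-⁅⁆ y))) (count-⟦⟧-unique u))
  (count-∪-disjoint ⁅ y ⁆ ⟦ ys ⟧ disjoint)
  where
  disjoint : Disjoint ⁅ y ⁆ ⟦ ys ⟧
  disjoint x x≡y with x ≟ y
  disjoint x () | no _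
  ... | yes refl = ∉⇒∉⟦⟧ (All¬⇒¬Any y∉)

in-neighbours : ∀ {n} → Digraph n → Fin n → VSet n
in-neighbours D v u = D u v

indegree : ∀ {n} → Digraph n → Fin n → ℕ
indegree D = count ∘ in-neighbours D

IsMaximum : ∀ {n} → Digraph n → Fin n → Set
IsMaximum D v = ∀ u → indegree D u ≤ indegree D v

maximum-indegree : ∀ {n} (D : Digraph (suc n)) → ∃ (IsMaximum D)
maximum-indegree {n} D = v , λ u → All.lookup (f[xs]≤f[argmax] {f = indegree D} zero vertices) (∈-allFin u)
  where
  vertices = allFin (suc n)
  v = argmax (indegree D) zero vertices

module OrientationProperties {n} {G : Graph n} {D : Digraph n}
  (orientation : IsOrientation G D) (simple : IsSimple D) (acyclic : IsCliqueAcyclic G D) where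

  adj⇒≢ : ∀ {u v} → Adj G u v → u ≢ v
  adj⇒≢ uv refl = irrefl G uv

  arc⇒adj : ∀ {u v} → D u v ≡ true → Adj G u v
  arc⇒adj = proj₁ orientation _ _

  adj⇒arc : ∀ {u v} → Adj G u v → D u v ≡ false → D v u ≡ true
  adj⇒arc {u} {v} uv ¬uv with proj₂ orientation u v uv
  ... | inj₁ p = contradictionᵇ p ¬uv
  ... | inj₂ p = p

  ¬adj⇒¬arc : ∀ {u v} → ¬ Adj G u v → D u v ≡ false
  ¬adj⇒¬arc {u} {v} ¬uv with D u v in e
  ... | true  = contradiction (arc⇒adj e) ¬uv
  ... | false = refl

  asymmetric : ∀ {u v} → D u v ≡ true → D v u ≡ true → ⊥
  asymmetric {u} {v} uv vu = contradictionᵇ vu (simple u v uv)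

  triangle-clique : ∀ {a b c} → Adj G a b → Adj G b c → Adj G a c → IsClique G ⟦ a ∷ b ∷ c ∷ [] ⟧
  triangle-clique {a} {b} {c} ab bc ac =
    (a , ∈⇒∈⟦⟧ (a ∷ b ∷ c ∷ []) (here refl)) ,
    λ u w u∈ w∈ → pair (∈⟦⟧⇒∈ (a ∷ b ∷ c ∷ []) u∈) (∈⟦⟧⇒∈ (a ∷ b ∷ c ∷ []) w∈)
    where
    pair : ∀ {u w} → u ∈ a ∷ b ∷ c ∷ [] → w ∈ a ∷ b ∷ c ∷ [] → u ≢ w → Adj G u w
    pair (here refl)                 (here refl)                 u≢w = contradiction refl u≢w
    pair (here refl)                 (there (here refl))         _   = ab
    pair (here refl)                 (there (there (here refl))) _   = ac
    pair (there (here refl))         (here refl)                 _   = Graph.sym G ab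
    pair (there (here refl))         (there (here refl))         u≢w = contradiction refl u≢w
    pair (there (here refl))         (there (there (here refl))) _   = bc
    pair (there (there (here refl))) (here refl)                 _   = Graph.sym G ac
    pair (there (there (here refl))) (there (here refl))         _   = Graph.sym G bc
    pair (there (there (here refl))) (there (there (here refl))) u≢w = contradiction refl u≢w

  -- The sink of the triangle {a, b, c} can only be c.
  transitive : ∀ {a b c} → Adj G a c → D a b ≡ true → D b c ≡ true → D a c ≡ true
  transitive {a} {b} {c} ac ab bc
    with acyclic ⟦ a ∷ b ∷ c ∷ [] ⟧ (triangle-clique (arc⇒adj ab) (arc⇒adj bc) ac)
  ... | q , q∈ , sink with ∈⟦⟧⇒∈ {x = q} (a ∷ b ∷ c ∷ []) q∈
  ... | here refl = ⊥-elim (asymmetric ab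
    (sink b (∈⇒∈⟦⟧ (a ∷ b ∷ c ∷ []) (there (here refl))) (adj⇒≢ (Graph.sym G (arc⇒adj ab)))))
  ... | there (here refl) = ⊥-elim (asymmetric bc
    (sink c (∈⇒∈⟦⟧ (a ∷ b ∷ c ∷ []) (there (there (here refl)))) (adj⇒≢ (Graph.sym G (arc⇒adj bc)))))
  ... | there (there (here refl)) = sink a (∈⇒∈⟦⟧ (a ∷ b ∷ c ∷ []) (here refl)) (adj⇒≢ ac)

  in-neighbours-⊆ : ∀ {v u} E → D v u ≡ true → (∀ w → D w v ≡ true → ¬ Adj G w u → w ∈ E) →
    in-neighbours D v ⊆ in-neighbours D u ∪ ⟦ E ⟧
  in-neighbours-⊆ {v} {u} E vu outside w wv with D w u in wu
  ... | true  = refl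
  ... | false = ∈⇒∈⟦⟧ E (outside w wv λ adj → contradictionᵇ (transitive adj wv vu) wu)

  -- By transitivity, u inherits every in-neighbour of v that is adjacent to u.
  indegree-gain : ∀ {v u} Gs E → D v u ≡ true → Unique Gs →
    All (λ g → D g u ≡ true × D g v ≡ false) Gs → (∀ w → D w v ≡ true → ¬ Adj G w u → w ∈ E) →
    indegree D v + length Gs ≤ indegree D u + length E
  indegree-gain {v} {u} Gs E vu unique gains outside = begin
    indegree D v + length Gs                  ≤⟨ +-monoʳ-≤ (indegree D v) (count-⟦⟧-unique unique) ⟩
    count (in-neighbours D v) + count ⟦ Gs ⟧  ≤⟨ count-∪-disjoint (in-neighbours D v) ⟦ Gs ⟧ disjoint ⟩
    count (in-neighbours D v ∪ ⟦ Gs ⟧)        ≤⟨ count-mono (∪-lub (in-neighbours-⊆ E vu outside) gained) ⟩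
    count (in-neighbours D u ∪ ⟦ E ⟧)         ≤⟨ count-∪ (in-neighbours D u) ⟦ E ⟧ ⟩
    indegree D u + count ⟦ E ⟧                ≤⟨ +-monoʳ-≤ (indegree D u) (count-⟦⟧ E) ⟩
    indegree D u + length E                   ∎
    where
    open ≤-Reasoning
    disjoint : Disjoint (in-neighbours D v) ⟦ Gs ⟧
    disjoint w wv with ⟦ Gs ⟧ w in e
    ... | true  = contradictionᵇ wv (proj₂ (All.lookup gains (∈⟦⟧⇒∈ Gs e)))
    ... | false = refl
    gained : ⟦ Gs ⟧ ⊆ in-neighbours D u ∪ ⟦ E ⟧
    gained w w∈ =
      p⊆p∪q {p = in-neighbours D u} {q = ⟦ E ⟧} w (proj₁ (All.lookup gains (∈⟦⟧⇒∈ Gs w∈)))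

cycAdj-sym : ∀ {n} {u v : Fin n} → CycAdj n u v → CycAdj n v u
cycAdj-sym (inj₁ p)                = inj₂ (inj₁ p)
cycAdj-sym (inj₂ (inj₁ p))         = inj₁ p
cycAdj-sym (inj₂ (inj₂ (inj₁ p)))  = inj₂ (inj₂ (inj₂ p))
cycAdj-sym (inj₂ (inj₂ (inj₂ p)))  = inj₂ (inj₂ (inj₁ p))

cycAdj? : ∀ n (u v : Fin n) → Dec (CycAdj n u v)
cycAdj? n u v =
  (suc (toℕ u) Data.Nat.≟ toℕ v) ⊎-dec (suc (toℕ v) Data.Nat.≟ toℕ u) ⊎-dec
  ((toℕ u Data.Nat.≟ 0) ×-dec (suc (toℕ v) Data.Nat.≟ n)) ⊎-dec
  ((toℕ v Data.Nat.≟ 0) ×-dec (suc (toℕ u) Data.Nat.≟ n))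

antiHoleAdj? : ∀ n (u v : Fin n) → Dec (AntiHoleAdj n u v)
antiHoleAdj? n u v = ¬? (u ≟ v) ×-dec ¬? (cycAdj? n u v)

-- x ⊕ d is the vertex d steps after x along the cycle C_n.  Reading the cycle
-- backwards is again a rotation, so each argument below also holds mirrored.
record Rotation (n : ℕ) : Set where
  infixl 6 _⊕_
  field
    _⊕_         : Fin n → ℕ → Fin n
    ⊕-assoc     : ∀ x a b → x ⊕ a ⊕ b ≡ x ⊕ (a + b)
    ⊕-identityʳ : ∀ x → x ⊕ 0 ≡ x
    ⊕-period    : ∀ x → x ⊕ n ≡ x
    ⊕-free      : ∀ x d → d < n → x ⊕ d ≡ x → d ≡ 0
    ⊕-reach     : ∀ x y → ∃ λ d → d < n × y ≡ x ⊕ d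
    cyc⇒⊕1      : ∀ {x y} → CycAdj n x y → y ≡ x ⊕ 1 ⊎ x ≡ y ⊕ 1
    ⊕1-cyc      : ∀ x → CycAdj n x (x ⊕ 1)

module RotationProperties {m : ℕ} (ρ : Rotation (suc m)) where
  open Rotation ρ public

  N : ℕ
  N = suc m

  ⊕-assoc-comm : ∀ x a b → x ⊕ a ⊕ b ≡ x ⊕ (b + a)
  ⊕-assoc-comm x a b = trans (⊕-assoc x a b) (cong (x ⊕_) (+-comm a b))

  ⊕-multiple : ∀ x c → x ⊕ (c * N) ≡ x
  ⊕-multiple x zero    = ⊕-identityʳ x
  ⊕-multiple x (suc c) = begin
    x ⊕ (N + c * N) ≡⟨ ⊕-assoc x N (c * N) ⟨
    x ⊕ N ⊕ (c * N) ≡⟨ cong (_⊕ (c * N)) (⊕-period x) ⟩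
    x ⊕ (c * N)     ≡⟨ ⊕-multiple x c ⟩
    x               ∎
    where open ≡-Reasoning

  ⊕-injective : ∀ x {a b} → a < b → b < N → x ⊕ a ≢ x ⊕ b
  ⊕-injective x {a} {b} a<b b<N eq = <-irrefl (sym b∸a≡0) (m<n⇒0<n∸m a<b)
    where
    open ≡-Reasoning
    b∸a≡0 : b ∸ a ≡ 0
    b∸a≡0 = ⊕-free (x ⊕ a) (b ∸ a) (≤-<-trans (m∸n≤m b a) b<N) (begin
      x ⊕ a ⊕ (b ∸ a)   ≡⟨ ⊕-assoc x a (b ∸ a) ⟩
      x ⊕ (a + (b ∸ a)) ≡⟨ cong (x ⊕_) (m+[n∸m]≡n (<⇒≤ a<b)) ⟩
      x ⊕ b             ≡⟨ eq ⟨
      x ⊕ a             ∎)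

  ⊕1⊕m : ∀ x → x ⊕ 1 ⊕ m ≡ x
  ⊕1⊕m x = trans (⊕-assoc x 1 m) (⊕-period x)

  ⊕m⊕1 : ∀ x → x ⊕ m ⊕ 1 ≡ x
  ⊕m⊕1 x = trans (⊕-assoc-comm x m 1) (⊕-period x)

  adj-⊕ : ∀ x {d} → 2 ≤ d → d + 2 ≤ N → AntiHoleAdj N x (x ⊕ d)
  adj-⊕ x {d} 2≤d d+2≤N = x≢x⊕d , ¬cyc
    where
    0<d : 0 < d
    0<d = ≤-trans (s≤s z≤n) 2≤d
    d<N : d < N
    d<N = ≤-trans (n≤1+n (suc d)) (subst (_≤ N) (+-comm d 2) d+2≤N)
    x≢x⊕d : x ≢ x ⊕ d
    x≢x⊕d eq = ⊕-injective x 0<d d<N (trans (⊕-identityʳ x) eq)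
    ¬cyc : ¬ CycAdj N x (x ⊕ d)
    ¬cyc c with cyc⇒⊕1 c
    ... | inj₁ eq = ⊕-injective x 2≤d d<N (sym eq)
    ... | inj₂ eq = ⊕-injective x (m≤n+m 1 d) (subst (_≤ N) (+-suc d 1) d+2≤N)
                      (trans (⊕-identityʳ x) (trans eq (⊕-assoc x d 1)))

  ¬adj-⊕1 : ∀ x → ¬ AntiHoleAdj N x (x ⊕ 1)
  ¬adj-⊕1 x (_ , ¬cyc) = ¬cyc (⊕1-cyc x)

  non-neighbour : ∀ {u w} → ¬ AntiHoleAdj N u w → w ≡ u ⊎ w ≡ u ⊕ 1 ⊎ w ≡ u ⊕ m
  non-neighbour {u} {w} ¬adj with u ≟ w
  ... | yes refl = inj₁ refl
  ... | no u≢w with cycAdj? N u w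
  ...   | no ¬cyc = contradiction (u≢w , ¬cyc) ¬adj
  ...   | yes cyc with cyc⇒⊕1 cyc
  ...     | inj₁ w≡u⊕1 = inj₂ (inj₁ w≡u⊕1)
  ...     | inj₂ u≡w⊕1 = inj₂ (inj₂ (trans (sym (⊕1⊕m w)) (cong (_⊕ m) (sym u≡w⊕1))))

  neighbour : ∀ {u w} → w ≢ u → w ≢ u ⊕ 1 → w ≢ u ⊕ m → AntiHoleAdj N u w
  neighbour {u} {w} ≢u ≢u⊕1 ≢u⊕m with antiHoleAdj? N u w
  ... | yes adj  = adj
  ... | no ¬adj = ⊥-elim ([ ≢u , [ ≢u⊕1 , ≢u⊕m ]′ ]′ (non-neighbour ¬adj))

module StandardRotation (m : ℕ) where
  N : ℕ
  N = suc m

  infixl 6 _⊕_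
  _⊕_ : Fin N → ℕ → Fin N
  x ⊕ d = fromℕ< (m%n<n (toℕ x + d) N)

  toℕ-⊕ : ∀ x d → toℕ (x ⊕ d) ≡ (toℕ x + d) % N
  toℕ-⊕ x d = toℕ-fromℕ< _

  toℕ%N : ∀ (x : Fin N) → toℕ x % N ≡ toℕ x
  toℕ%N x = m<n⇒m%n≡m (toℕ<n x)

  [a%N+b]%N : ∀ a b → (a % N + b) % N ≡ (a + b) % N
  [a%N+b]%N a b = begin
    (a % N + b) % N         ≡⟨ %-distribˡ-+ (a % N) b N ⟩
    (a % N % N + b % N) % N ≡⟨ cong (λ z → (z + b % N) % N) (m%n%n≡m%n a N) ⟩
    (a % N + b % N) % N     ≡⟨ %-distribˡ-+ a b N ⟨
    (a + b) % N             ∎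
    where open ≡-Reasoning

  ⊕-assoc : ∀ x a b → x ⊕ a ⊕ b ≡ x ⊕ (a + b)
  ⊕-assoc x a b = toℕ-injective (begin
    toℕ (x ⊕ a ⊕ b)           ≡⟨ toℕ-⊕ (x ⊕ a) b ⟩
    (toℕ (x ⊕ a) + b) % N     ≡⟨ cong (λ z → (z + b) % N) (toℕ-⊕ x a) ⟩
    ((toℕ x + a) % N + b) % N ≡⟨ [a%N+b]%N (toℕ x + a) b ⟩
    (toℕ x + a + b) % N       ≡⟨ cong (_% N) (+-assoc (toℕ x) a b) ⟩
    (toℕ x + (a + b)) % N     ≡⟨ toℕ-⊕ x (a + b) ⟨
    toℕ (x ⊕ (a + b))         ∎)
    where open ≡-Reasoning

  ⊕-identityʳ : ∀ x → x ⊕ 0 ≡ x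
  ⊕-identityʳ x = toℕ-injective (trans (toℕ-⊕ x 0) (trans (cong (_% N) (+-comm (toℕ x) 0)) (toℕ%N x)))

  ⊕-period : ∀ x → x ⊕ N ≡ x
  ⊕-period x = toℕ-injective (trans (toℕ-⊕ x N) (trans ([m+n]%n≡m%n (toℕ x) N) (toℕ%N x)))

  -- Writing toℕ x + d = toℕ (x ⊕ d) + q * N, the hypothesis forces d = q * N < N.
  ⊕-free : ∀ x d → d < N → x ⊕ d ≡ x → d ≡ 0
  ⊕-free x d d<N eq with (toℕ x + d) / N | d≡qN
    where
    q = (toℕ x + d) / N
    d≡qN : d ≡ q * N
    d≡qN = +-cancelˡ-≡ (toℕ x) d _ (begin
      toℕ x + d             ≡⟨ m≡m%n+[m/n]*n (toℕ x + d) N ⟩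
      (toℕ x + d) % N + q * N ≡⟨ cong (_+ q * N) (trans (sym (toℕ-⊕ x d)) (cong toℕ eq)) ⟩
      toℕ x + q * N         ∎)
      where open ≡-Reasoning
  ... | zero  | d≡0    = d≡0
  ... | suc q | d≡N+qN = contradiction d<N (≤⇒≯ (subst (N ≤_) (sym d≡N+qN) (m≤m+n N (q * N))))

  ⊕-reach : ∀ x y → ∃ λ d → d < N × y ≡ x ⊕ d
  ⊕-reach x y = d , m%n<n (toℕ y + (N ∸ toℕ x)) N , toℕ-injective (sym (begin
    toℕ (x ⊕ d)                          ≡⟨ toℕ-⊕ x d ⟩
    (toℕ x + d) % N                      ≡⟨ cong (_% N) (+-comm (toℕ x) d) ⟩
    (d + toℕ x) % N                      ≡⟨ [a%N+b]%N (toℕ y + (N ∸ toℕ x)) (toℕ x) ⟩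
    (toℕ y + (N ∸ toℕ x) + toℕ x) % N    ≡⟨ cong (_% N) (+-assoc (toℕ y) (N ∸ toℕ x) (toℕ x)) ⟩
    (toℕ y + (N ∸ toℕ x + toℕ x)) % N    ≡⟨ cong (λ z → (toℕ y + z) % N) (m∸n+n≡m (<⇒≤ (toℕ<n x))) ⟩
    (toℕ y + N) % N                      ≡⟨ [m+n]%n≡m%n (toℕ y) N ⟩
    toℕ y % N                            ≡⟨ toℕ%N y ⟩
    toℕ y                                ∎))
    where
    open ≡-Reasoning
    d = (toℕ y + (N ∸ toℕ x)) % N

  toℕ-⊕1 : ∀ x → toℕ (x ⊕ 1) ≡ suc (toℕ x) % N
  toℕ-⊕1 x = trans (toℕ-⊕ x 1) (cong (_% N) (+-comm (toℕ x) 1))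

  suc-toℕ⇒⊕1 : ∀ x y → suc (toℕ x) ≡ toℕ y → y ≡ x ⊕ 1
  suc-toℕ⇒⊕1 x y eq = toℕ-injective (sym (trans (toℕ-⊕1 x) (trans (cong (_% N) eq) (toℕ%N y))))

  wrap⇒⊕1 : ∀ x y → toℕ y ≡ 0 → suc (toℕ x) ≡ N → y ≡ x ⊕ 1
  wrap⇒⊕1 x y y≡0 eq =
    toℕ-injective (sym (trans (toℕ-⊕1 x) (trans (cong (_% N) eq) (trans (n%n≡0 N) (sym y≡0)))))

  cyc⇒⊕1 : ∀ {x y} → CycAdj N x y → y ≡ x ⊕ 1 ⊎ x ≡ y ⊕ 1
  cyc⇒⊕1 {x} {y} (inj₁ eq)                      = inj₁ (suc-toℕ⇒⊕1 x y eq)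
  cyc⇒⊕1 {x} {y} (inj₂ (inj₁ eq))               = inj₂ (suc-toℕ⇒⊕1 y x eq)
  cyc⇒⊕1 {x} {y} (inj₂ (inj₂ (inj₁ (x≡0 , eq)))) = inj₂ (wrap⇒⊕1 y x x≡0 eq)
  cyc⇒⊕1 {x} {y} (inj₂ (inj₂ (inj₂ (y≡0 , eq)))) = inj₁ (wrap⇒⊕1 x y y≡0 eq)

  ⊕1-cyc : ∀ x → CycAdj N x (x ⊕ 1)
  ⊕1-cyc x with m≤n⇒m<n∨m≡n (toℕ<n x)
  ... | inj₁ 1+x<N = inj₁ (sym (trans (toℕ-⊕1 x) (m<n⇒m%n≡m 1+x<N)))
  ... | inj₂ 1+x≡N = inj₂ (inj₂ (inj₂ (trans (toℕ-⊕1 x) (trans (cong (_% N) 1+x≡N) (n%n≡0 N)) , 1+x≡N)))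

rotation : ∀ m → Rotation (suc m)
rotation m = record { StandardRotation m }

module ReverseRotation {m : ℕ} (ρ : Rotation (suc m)) where
  open RotationProperties ρ

  infixl 6 _⊖_
  _⊖_ : Fin N → ℕ → Fin N
  x ⊖ d = x ⊕ (m * d)

  ⊕-N* : ∀ x c → x ⊕ (N * c) ≡ x
  ⊕-N* x c = trans (cong (x ⊕_) (*-comm N c)) (⊕-multiple x c)

  ⊕⊖-cancel : ∀ x d → x ⊕ d ⊖ d ≡ x
  ⊕⊖-cancel x d = trans (⊕-assoc x d (m * d)) (⊕-N* x d)

  ⊖⊕-cancel : ∀ x d → x ⊖ d ⊕ d ≡ x
  ⊖⊕-cancel x d = trans (⊕-assoc-comm x (m * d) d) (⊕-N* x d)

  ⊕-⊖ : ∀ x i j → x ⊕ (i + j) ⊖ j ≡ x ⊕ i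
  ⊕-⊖ x i j = trans (cong (_⊖ j) (sym (⊕-assoc x i j))) (⊕⊖-cancel (x ⊕ i) j)

  ⊖-assoc : ∀ x a b → x ⊖ a ⊖ b ≡ x ⊖ (a + b)
  ⊖-assoc x a b = trans (⊕-assoc x (m * a) (m * b)) (cong (x ⊕_) (sym (*-distribˡ-+ m a b)))

  ⊖-identityʳ : ∀ x → x ⊖ 0 ≡ x
  ⊖-identityʳ x = trans (cong (x ⊕_) (*-zeroʳ m)) (⊕-identityʳ x)

  ⊖-period : ∀ x → x ⊖ N ≡ x
  ⊖-period x = ⊕-multiple x m

  ⊖-free : ∀ x d → d < N → x ⊖ d ≡ x → d ≡ 0
  ⊖-free x d d<N eq = ⊕-free x d d<N (trans (cong (_⊕ d) (sym eq)) (⊖⊕-cancel x d))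

  ⊖-reach : ∀ x y → ∃ λ d → d < N × y ≡ x ⊖ d
  ⊖-reach x y with ⊕-reach y x
  ... | d , d<N , x≡y⊕d = d , d<N , trans (sym (⊕⊖-cancel y d)) (cong (_⊖ d) (sym x≡y⊕d))

  ⊕1≡⇒≡⊖1 : ∀ {x y} → y ≡ x ⊕ 1 → x ≡ y ⊖ 1
  ⊕1≡⇒≡⊖1 {x} refl = sym (⊕⊖-cancel x 1)

  cyc⇒⊖1 : ∀ {x y} → CycAdj N x y → y ≡ x ⊖ 1 ⊎ x ≡ y ⊖ 1
  cyc⇒⊖1 c with cyc⇒⊕1 c
  ... | inj₁ y≡x⊕1 = inj₂ (⊕1≡⇒≡⊖1 y≡x⊕1)
  ... | inj₂ x≡y⊕1 = inj₁ (⊕1≡⇒≡⊖1 x≡y⊕1)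

  ⊖1-cyc : ∀ x → CycAdj N x (x ⊖ 1)
  ⊖1-cyc x = cycAdj-sym (subst (CycAdj N (x ⊖ 1)) (⊖⊕-cancel x 1) (⊕1-cyc (x ⊖ 1)))

reverse : ∀ {m} → Rotation (suc m) → Rotation (suc m)
reverse ρ = record
  { _⊕_         = _⊖_
  ; ⊕-assoc     = ⊖-assoc
  ; ⊕-identityʳ = ⊖-identityʳ
  ; ⊕-period    = ⊖-period
  ; ⊕-free      = ⊖-free
  ; ⊕-reach     = ⊖-reach
  ; cyc⇒⊕1      = cyc⇒⊖1
  ; ⊕1-cyc      = ⊖1-cyc
  }
  where open ReverseRotation ρ

module AntiHoleOrientation {m : ℕ} (3≤m : 3 ≤ m) (ρ : Rotation (suc m)) {D : Digraph (suc m)}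
  (orientation : IsOrientation (antiHole (suc m)) D) (simple : IsSimple D)
  (acyclic : IsCliqueAcyclic (antiHole (suc m)) D) where

  open RotationProperties ρ
  open OrientationProperties {G = antiHole N} orientation simple acyclic

  adj-sym : ∀ {u v} → AntiHoleAdj N u v → AntiHoleAdj N v u
  adj-sym = Graph.sym (antiHole N)

  adj-⊕2 : ∀ x → AntiHoleAdj N x (x ⊕ 2)
  adj-⊕2 x = adj-⊕ x (s≤s (s≤s z≤n)) (s≤s 3≤m)

  arc-⊕2 : ∀ x → D (x ⊕ 2) x ≡ false → D x (x ⊕ 2) ≡ true
  arc-⊕2 x = adj⇒arc (adj-sym (adj-⊕2 x))

  ¬arc-⊕1 : ∀ x → D x (x ⊕ 1) ≡ false
  ¬arc-⊕1 x = ¬adj⇒¬arc (¬adj-⊕1 x)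

  ¬arc-⊕1ˡ : ∀ x → D (x ⊕ 1) x ≡ false
  ¬arc-⊕1ˡ x = ¬adj⇒¬arc (¬adj-⊕1 x ∘ adj-sym)

  ¬loop : ∀ x → D x x ≡ false
  ¬loop x = ¬adj⇒¬arc (irrefl (antiHole N))

  gain : ∀ {v u} Gs E → D v u ≡ true → Unique Gs → All (λ g → D g u ≡ true × D g v ≡ false) Gs →
    (∀ w → D w v ≡ true → w ≡ u ⊕ 1 ⊎ w ≡ u ⊕ m → w ∈ E) →
    indegree D v + length Gs ≤ indegree D u + length E
  gain Gs E vu unique gains outside = indegree-gain Gs E vu unique gains λ w wv ¬wu →
    [ (λ { refl → ⊥-elim (asymmetric wv vu) }) , outside w wv ]′ (non-neighbour (¬wu ∘ adj-sym))

  gain-at-maximum : ∀ {v u} Gs E → IsMaximum D v → D v u ≡ true → Unique Gs →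
    All (λ g → D g u ≡ true × D g v ≡ false) Gs →
    (∀ w → D w v ≡ true → w ≡ u ⊕ 1 ⊎ w ≡ u ⊕ m → w ∈ E) → length Gs ≤ length E
  gain-at-maximum {v} {u} Gs E max vu unique gains outside = +-cancelˡ-≤ (indegree D v) _ _
    (≤-trans (gain Gs E vu unique gains outside) (+-monoˡ-≤ (length E) (max u)))

  maximum-⊕2 : ∀ {v} → IsMaximum D v → D v (v ⊕ 2) ≡ true → IsMaximum D (v ⊕ 2)
  maximum-⊕2 {v} max vu w = ≤-trans (max w) (+-cancelʳ-≤ 1 _ _
    (gain (v ∷ []) (v ⊕ 2 ⊕ 1 ∷ []) vu ([] ∷ []) ((vu , ¬loop v) ∷ []) outside))
    where
    outside : ∀ w → D w v ≡ true → w ≡ v ⊕ 2 ⊕ 1 ⊎ w ≡ v ⊕ 2 ⊕ m → w ∈ v ⊕ 2 ⊕ 1 ∷ []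
    outside w wv (inj₁ w≡) = here w≡
    outside w wv (inj₂ w≡) = contradictionᵇ wv (subst (λ z → D z v ≡ false) (sym w≡v⊕1) (¬arc-⊕1ˡ v))
      where
      w≡v⊕1 : w ≡ v ⊕ 1
      w≡v⊕1 = trans w≡ (trans (cong (_⊕ m) (sym (⊕-assoc v 1 1))) (⊕1⊕m (v ⊕ 1)))

  -- Otherwise u would have more in-neighbours than a ⊕ 1: it gains a ⊕ 1, a ⊕ 2 and
  -- (unless a = u ⊕ 1) also a, and loses at most the in-neighbours u ⊕ 1, u ⊕ m of a ⊕ 1.
  no-common-out-neighbour : ∀ a {u} → IsMaximum D (a ⊕ 1) → D a (a ⊕ 2) ≡ true → u ≢ a →
    D (a ⊕ 1) u ≡ true → D (a ⊕ 2) u ≡ true → ⊥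
  no-common-out-neighbour a {u} max ab u≢a vu bu = by-cases (a ≟ u ⊕ 1)
    where
    v = a ⊕ 1
    b = a ⊕ 2
    1<N : 1 < N
    1<N = s≤s (≤-trans (s≤s z≤n) 3≤m)
    2<N : 2 < N
    2<N = s≤s (≤-trans (s≤s (s≤s z≤n)) 3≤m)
    b≡v⊕1 : b ≡ v ⊕ 1
    b≡v⊕1 = sym (⊕-assoc a 1 1)
    v≢b : v ≢ b
    v≢b = ⊕-injective a (s≤s (s≤s z≤n)) 2<N
    v≢a : v ≢ a
    v≢a v≡a = ⊕-injective a (s≤s z≤n) 1<N (trans (⊕-identityʳ a) (sym v≡a))
    b≢a : b ≢ a
    b≢a b≡a = ⊕-injective a (s≤s z≤n) 2<N (trans (⊕-identityʳ a) (sym b≡a))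
    bv : D b v ≡ false
    bv = subst (λ z → D z v ≡ false) (sym b≡v⊕1) (¬arc-⊕1ˡ v)
    by-cases : Dec (a ≡ u ⊕ 1) → ⊥
    by-cases (yes a≡u⊕1) = 1+n≰n (gain-at-maximum (v ∷ b ∷ []) (u ⊕ m ∷ []) max vu
      ((v≢b ∷ []) ∷ [] ∷ []) ((vu , ¬loop v) ∷ (bu , bv) ∷ []) outside)
      where
      outside : ∀ w → D w v ≡ true → w ≡ u ⊕ 1 ⊎ w ≡ u ⊕ m → w ∈ u ⊕ m ∷ []
      outside w wv (inj₁ w≡u⊕1) =
        contradictionᵇ wv (subst (λ z → D z v ≡ false) (trans a≡u⊕1 (sym w≡u⊕1)) (¬arc-⊕1 a))
      outside w wv (inj₂ w≡u⊕m) = here w≡u⊕m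
    by-cases (no a≢u⊕1) = 1+n≰n (gain-at-maximum (v ∷ b ∷ a ∷ []) (u ⊕ 1 ∷ u ⊕ m ∷ []) max vu
      ((v≢b ∷ v≢a ∷ []) ∷ (b≢a ∷ []) ∷ [] ∷ [])
      ((vu , ¬loop v) ∷ (bu , bv) ∷ (au , ¬arc-⊕1 a) ∷ []) outside)
      where
      u≢v : u ≢ v
      u≢v = adj⇒≢ (adj-sym (arc⇒adj vu))
      au : D a u ≡ true
      au = transitive (neighbour u≢a u≢v λ u≡a⊕m → a≢u⊕1 (sym (trans (cong (_⊕ 1) u≡a⊕m) (⊕m⊕1 a))))
        ab bu
      outside : ∀ w → D w v ≡ true → w ≡ u ⊕ 1 ⊎ w ≡ u ⊕ m → w ∈ u ⊕ 1 ∷ u ⊕ m ∷ []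
      outside w wv (inj₁ w≡u⊕1) = here w≡u⊕1
      outside w wv (inj₂ w≡u⊕m) = there (here w≡u⊕m)

  consecutive-kernel : ∀ a → IsMaximum D (a ⊕ 1) → D a (a ⊕ 2) ≡ true →
    D (a ⊕ 1 ⊕ 2) (a ⊕ 1) ≡ true → HasKernel (antiHole N) D
  consecutive-kernel a max ab cv = S , independent , absorbing
    where
    v = a ⊕ 1
    b = a ⊕ 2
    S = ⟦ v ∷ b ∷ [] ⟧
    b≡v⊕1 : b ≡ v ⊕ 1
    b≡v⊕1 = sym (⊕-assoc a 1 1)
    ¬vb : ¬ AntiHoleAdj N v b
    ¬vb = subst (λ z → ¬ AntiHoleAdj N v z) (sym b≡v⊕1) (¬adj-⊕1 v)
    independent : ∀ x y → S x ≡ true → S y ≡ true → ¬ AntiHoleAdj N x y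
    independent x y x∈ y∈ with ∈⟦⟧⇒∈ {x = x} (v ∷ b ∷ []) x∈ | ∈⟦⟧⇒∈ {x = y} (v ∷ b ∷ []) y∈
    ... | here refl         | here refl         = irrefl (antiHole N)
    ... | here refl         | there (here refl) = ¬vb
    ... | there (here refl) | here refl         = ¬vb ∘ adj-sym
    ... | there (here refl) | there (here refl) = irrefl (antiHole N)
    absorbing : ∀ u → S u ≡ false → ∃ λ w → S w ≡ true × D u w ≡ true
    absorbing u u∉ with D u v in uv | D u b in ub
    ... | true  | _     = v , ∈⇒∈⟦⟧ (v ∷ b ∷ []) (here refl) , uv
    ... | false | true  = b , ∈⇒∈⟦⟧ (v ∷ b ∷ []) (there (here refl)) , ub
    ... | false | false =
      ⊥-elim (no-common-out-neighbour a max ab u≢a (adj⇒arc (adj-sym adj-vu) uv) (adj⇒arc (adj-sym adj-bu) ub))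
      where
      u≢v : u ≢ v
      u≢v refl = contradictionᵇ (∈⇒∈⟦⟧ (v ∷ b ∷ []) (here refl)) u∉
      u≢b : u ≢ b
      u≢b refl = contradictionᵇ (∈⇒∈⟦⟧ (v ∷ b ∷ []) (there (here refl))) u∉
      u≢a : u ≢ a
      u≢a refl = contradictionᵇ ab ub
      adj-vu : AntiHoleAdj N v u
      adj-vu = neighbour u≢v
        (λ u≡v⊕1 → u≢b (trans u≡v⊕1 (sym b≡v⊕1)))
        (λ u≡v⊕m → u≢a (trans u≡v⊕m (⊕1⊕m a)))
      adj-bu : AntiHoleAdj N b u
      adj-bu = neighbour u≢b
        (λ u≡b⊕1 → contradictionᵇ cv (subst (λ z → D z v ≡ false) (trans u≡b⊕1 b⊕1≡v⊕2) uv))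
        (λ u≡b⊕m → u≢v (trans u≡b⊕m (trans (cong (_⊕ m) b≡v⊕1) (⊕1⊕m v))))
        where
        b⊕1≡v⊕2 : b ⊕ 1 ≡ v ⊕ 2
        b⊕1≡v⊕2 = trans (⊕-assoc a 2 1) (sym (⊕-assoc a 1 2))

  -- With every arc y → y ⊕ 2, transitivity pushes arcs along even distances; going once
  -- around the odd cycle turns x ⊕ 3 → x ⊕ 6 → ... into x ⊕ 3 → x, while x → x ⊕ 6 → x ⊕ 3.
  ¬all-forward : ∀ k → 4 ≤ k → N ≡ suc (k * 2) → ¬ (∀ y → D y (y ⊕ 2) ≡ true)
  ¬all-forward (suc (suc j)) (s≤s (s≤s 2≤j)) N≡ forward = asymmetric x→x⊕3 (back3 x)
    where
    x : Fin N
    x = zero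
    9≤N : 9 ≤ N
    9≤N = subst (9 ≤_) (sym N≡) (s≤s (s≤s (s≤s (*-monoˡ-≤ 2 (s≤s 2≤j)))))
    chain : ∀ y i → suc i * 2 + 2 ≤ N → D y (y ⊕ (suc i * 2)) ≡ true
    chain y zero    _ = forward y
    chain y (suc i) h = transitive (adj-⊕ y (s≤s (s≤s z≤n)) h) (chain y i (m+n≤o⇒n≤o 2 h))
      (subst (λ z → D (y ⊕ (suc i * 2)) z ≡ true) (⊕-assoc-comm y (suc i * 2) 2) (forward (y ⊕ (suc i * 2))))
    back3 : ∀ y → D (y ⊕ 3) y ≡ true
    back3 y = subst (λ z → D (y ⊕ 3) z ≡ true) around
      (chain (y ⊕ 3) j (subst (suc j * 2 + 2 ≤_) (sym N≡)
        (≤-trans (≤-reflexive (+-comm (suc j * 2) 2)) (n≤1+n _))))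
      where
      around : y ⊕ 3 ⊕ (suc j * 2) ≡ y
      around = trans (⊕-assoc y 3 (suc j * 2)) (trans (cong (y ⊕_) (sym N≡)) (⊕-period y))
    x→x⊕3 : D x (x ⊕ 3) ≡ true
    x→x⊕3 = transitive (adj-⊕ x (s≤s (s≤s z≤n)) (≤-trans (s≤s (s≤s (s≤s (s≤s (s≤s z≤n))))) 9≤N))
      (chain x 2 (≤-trans (n≤1+n 8) 9≤N))
      (subst (λ z → D z (x ⊕ 3) ≡ true) (⊕-assoc x 3 3) (back3 (x ⊕ 3)))

module SimpleOrientationKernel (k : ℕ) (4≤k : 4 ≤ k) {D : Digraph (suc (2 * k))}
  (orientation : IsOrientation (antiHole (suc (2 * k))) D) (simple : IsSimple D)
  (acyclic : IsCliqueAcyclic (antiHole (suc (2 * k))) D) where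

  3≤2k : 3 ≤ 2 * k
  3≤2k = ≤-trans (s≤s (s≤s (s≤s z≤n))) (*-monoʳ-≤ 2 4≤k)

  -- Walking around the odd cycle in steps of 2 from a Ready vertex either finds a kernel
  -- or shows that every arc y → y ⊕ 2 is present, which ¬all-forward refutes.
  module Along (ρ : Rotation (suc (2 * k))) where
    open RotationProperties ρ
    open ReverseRotation ρ using (_⊖_; ⊕⊖-cancel)
    open AntiHoleOrientation 3≤2k ρ orientation simple acyclic
    private module Mirror = AntiHoleOrientation 3≤2k (reverse ρ) orientation simple acyclic

    Forward : Fin N → Set
    Forward y = D y (y ⊕ 2) ≡ true

    Ready : Fin N → Set
    Ready a = IsMaximum D (a ⊕ 1) × Forward a

    mirrored-kernel : ∀ a → IsMaximum D (a ⊕ 1 ⊕ 2) → D (a ⊕ 2 ⊕ 2) (a ⊕ 2) ≡ true →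
      Forward (a ⊕ 1) → HasKernel (antiHole N) D
    mirrored-kernel a max db vc = Mirror.consecutive-kernel (a ⊕ 2 ⊕ 2)
      (subst (IsMaximum D) (sym e₁) max)
      (subst (λ z → D (a ⊕ 2 ⊕ 2) z ≡ true) (sym (⊕⊖-cancel (a ⊕ 2) 2)) db)
      (subst₂ (λ y z → D y z ≡ true) (sym e₂) (sym e₁) vc)
      where
      e₁ : a ⊕ 2 ⊕ 2 ⊖ 1 ≡ a ⊕ 1 ⊕ 2
      e₁ = trans (cong (_⊖ 1) (trans (⊕-assoc a 2 2) (sym (trans (⊕-assoc (a ⊕ 1) 2 1) (⊕-assoc a 1 3)))))
                 (⊕⊖-cancel (a ⊕ 1 ⊕ 2) 1)
      e₂ : a ⊕ 2 ⊕ 2 ⊖ 1 ⊖ 2 ≡ a ⊕ 1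
      e₂ = trans (cong (_⊖ 2) e₁) (⊕⊖-cancel (a ⊕ 1) 2)

    forward-step : ∀ a → IsMaximum D (a ⊕ 1 ⊕ 2) → Forward (a ⊕ 1) →
      HasKernel (antiHole N) D ⊎ Ready (a ⊕ 2)
    forward-step a max vc with D (a ⊕ 2 ⊕ 2) (a ⊕ 2) in db
    ... | true  = inj₁ (mirrored-kernel a max db vc)
    ... | false =
      inj₂ (subst (IsMaximum D) (trans (⊕-assoc a 1 2) (sym (⊕-assoc a 2 1))) max , arc-⊕2 (a ⊕ 2) db)

    ready-step : ∀ a → Ready a → HasKernel (antiHole N) D ⊎ (Forward (a ⊕ 1) × Ready (a ⊕ 2))
    ready-step a (max , ab) with D (a ⊕ 1 ⊕ 2) (a ⊕ 1) in cv
    ... | true  = inj₁ (consecutive-kernel a max ab cv)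
    ... | false with forward-step a (maximum-⊕2 max (arc-⊕2 (a ⊕ 1) cv)) (arc-⊕2 (a ⊕ 1) cv)
    ...   | inj₁ κ = inj₁ κ
    ...   | inj₂ r = inj₂ (arc-⊕2 (a ⊕ 1) cv , r)

    ready-iterate : ∀ a → Ready a → ∀ j →
      HasKernel (antiHole N) D ⊎ (Ready (a ⊕ (j * 2)) × (∀ d → d < j * 2 → Forward (a ⊕ suc d)))
    ready-iterate a r zero = inj₂ (subst Ready (sym (⊕-identityʳ a)) r , λ _ ())
    ready-iterate a r (suc j) with ready-iterate a r j
    ... | inj₁ κ = inj₁ κ
    ... | inj₂ (rⱼ , forward) with ready-step (a ⊕ (j * 2)) rⱼ
    ...   | inj₁ κ = inj₁ κ
    ...   | inj₂ (f₁ , r₂) = inj₂ (subst Ready (⊕-assoc-comm a (j * 2) 2) r₂ , extend)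
      where
      extend : ∀ d → d < suc j * 2 → Forward (a ⊕ suc d)
      extend d d< with m<1+n⇒m<n∨m≡n d<
      ... | inj₂ refl = subst Forward (⊕-assoc-comm a (j * 2) 2) (proj₂ r₂)
      ... | inj₁ d<′ with m<1+n⇒m<n∨m≡n d<′
      ...   | inj₁ d<″ = forward d d<″
      ...   | inj₂ refl = subst Forward (⊕-assoc-comm a (j * 2) 1) f₁

    ready⇒kernel : ∀ a → Ready a → HasKernel (antiHole N) D
    ready⇒kernel a r with ready-iterate a r (suc k)
    ... | inj₁ κ            = κ
    ... | inj₂ (_ , forward) = ⊥-elim (¬all-forward k 4≤k (cong suc (*-comm 2 k)) everywhere)
      where
      everywhere : ∀ y → Forward y
      everywhere y with ⊕-reach (a ⊕ 1) y
      ... | d , d<N , refl = subst Forward (sym (⊕-assoc a 1 d))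
        (forward d (≤-trans d<N (≤-trans (≤-reflexive (cong suc (*-comm 2 k))) (n≤1+n _))))

  -- Start at a vertex v of maximum in-degree; the edge between its two cycle
  -- neighbours is oriented one way or the other, giving Ready in ρ or in reverse ρ.
  kernel : HasKernel (antiHole (suc (2 * k))) D
  kernel = from-maximum (maximum-indegree D)
    where
    ρ = rotation (2 * k)
    open RotationProperties ρ
    open ReverseRotation ρ using (⊕-⊖; ⊕⊖-cancel)
    open AntiHoleOrientation 3≤2k ρ orientation simple acyclic using (adj-⊕2)
    open OrientationProperties {G = antiHole N} orientation simple acyclic using (adj⇒arc)
    from-maximum : ∃ (IsMaximum D) → HasKernel (antiHole N) D
    from-maximum (v , max) with D (v ⊕ (2 * k)) (v ⊕ (2 * k) ⊕ 2) in e
    ... | true  = Along.ready⇒kernel ρ (v ⊕ (2 * k)) (subst (IsMaximum D) (sym (⊕m⊕1 v)) max , e)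
    ... | false = Along.ready⇒kernel (reverse ρ) (a ⊕ 2)
      ( subst (IsMaximum D) (sym (trans (⊕-⊖ a 1 1) (⊕m⊕1 v))) max
      , subst (λ z → D (a ⊕ 2) z ≡ true) (sym (⊕⊖-cancel a 2)) (adj⇒arc (adj-⊕2 a) e))
      where a = v ⊕ (2 * k)

simple-kernel-solvable : ∀ k → 4 ≤ k → SimpleKernelSolvable (antiHole (suc (2 * k)))
simple-kernel-solvable k 4≤k D orientation simple acyclic =
  SimpleOrientationKernel.kernel k 4≤k orientation simple acyclic

-- Each edge {x, x ⊕ 2} is oriented x → x ⊕ 2 only; every other edge is reversible.
module KernelFreeOrientation (k : ℕ) (2≤k : 2 ≤ k) where
  open RotationProperties (rotation (2 * k))

  adj-sym : ∀ {u v} → AntiHoleAdj N u v → AntiHoleAdj N v u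
  adj-sym = Graph.sym (antiHole N)

  4<N : 4 < N
  4<N = s≤s (*-monoʳ-≤ 2 2≤k)

  arc? : (x y : Fin N) → Dec (AntiHoleAdj N x y × y ⊕ 2 ≢ x)
  arc? x y = antiHoleAdj? N x y ×-dec ¬? (y ⊕ 2 ≟ x)

  D : Digraph N
  D x y = does (arc? x y)

  arc⇒ : ∀ {x y} → D x y ≡ true → AntiHoleAdj N x y × y ⊕ 2 ≢ x
  arc⇒ {x} {y} = does-true (arc? x y)

  ⇒arc : ∀ {x y} → AntiHoleAdj N x y → y ⊕ 2 ≢ x → D x y ≡ true
  ⇒arc {x} {y} adj ne = dec-true (arc? x y) (adj , ne)

  ⊕2⊕2≢ : ∀ x → x ⊕ 2 ⊕ 2 ≢ x
  ⊕2⊕2≢ x eq = ⊕-injective x (s≤s z≤n) 4<N (trans (⊕-identityʳ x) (sym (trans (sym (⊕-assoc x 2 2)) eq)))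

  orientation : IsOrientation (antiHole N) D
  orientation = (λ _ _ → proj₁ ∘ arc⇒) , edge
    where
    edge : ∀ u v → AntiHoleAdj N u v → D u v ≡ true ⊎ D v u ≡ true
    edge u v adj = decide (v ⊕ 2 ≟ u)
      where
      decide : Dec (v ⊕ 2 ≡ u) → D u v ≡ true ⊎ D v u ≡ true
      decide (no v⊕2≢u)  = inj₁ (⇒arc adj v⊕2≢u)
      decide (yes v⊕2≡u) =
        inj₂ (⇒arc (adj-sym adj) λ u⊕2≡v → ⊕2⊕2≢ v (trans (cong (_⊕ 2) v⊕2≡u) u⊕2≡v))

  escape : ∀ (Q : VSet N) x j → Q x ≡ true →
    (∃ λ q → Q q ≡ true × Q (q ⊕ 2) ≡ false) ⊎ Q (x ⊕ (j * 2)) ≡ true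
  escape Q x zero    x∈ = inj₂ (subst (λ z → Q z ≡ true) (sym (⊕-identityʳ x)) x∈)
  escape Q x (suc j) x∈ with escape Q x j x∈
  ... | inj₁ found = inj₁ found
  ... | inj₂ xⱼ∈ with Q (x ⊕ (j * 2) ⊕ 2) in e
  ...   | true  = inj₂ (subst (λ z → Q z ≡ true) (⊕-assoc-comm x (j * 2) 2) e)
  ...   | false = inj₁ (x ⊕ (j * 2) , xⱼ∈ , e)

  -- Stepping by 2 from q₀, a clique must leave itself before reaching q₀ ⊕ (k + 1) * 2 = q₀ ⊕ 1;
  -- the last vertex q before leaving is a sink of the clique.
  clique-acyclic : IsCliqueAcyclic (antiHole N) D
  clique-acyclic Q ((q₀ , q₀∈) , clique) with escape Q q₀ (suc k) q₀∈
  ... | inj₁ (q , q∈ , q⊕2∉) =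
    q , q∈ , λ v v∈ v≢q → ⇒arc (clique v q v∈ q∈ v≢q)
      λ q⊕2≡v → contradictionᵇ v∈ (subst (λ z → Q z ≡ false) q⊕2≡v q⊕2∉)
  ... | inj₂ q₀⊕1∈ =
    ⊥-elim (¬adj-⊕1 q₀ (clique q₀ (q₀ ⊕ 1) q₀∈ (subst (λ z → Q z ≡ true) around q₀⊕1∈) q₀≢q₀⊕1))
    where
    around : q₀ ⊕ (suc k * 2) ≡ q₀ ⊕ 1
    around = trans (cong (λ d → q₀ ⊕ suc (suc d)) (*-comm k 2))
                   (trans (sym (⊕-assoc q₀ 1 N)) (⊕-period (q₀ ⊕ 1)))
    q₀≢q₀⊕1 : q₀ ≢ q₀ ⊕ 1
    q₀≢q₀⊕1 eq = ⊕-injective q₀ (s≤s z≤n) (≤-trans (s≤s (s≤s z≤n)) 4<N) (trans (⊕-identityʳ q₀) eq)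

  ¬arc-⊕1 : ∀ x {z} → z ≡ x ⊎ z ≡ x ⊕ 1 ⊎ z ≡ x ⊕ (2 * k) → D (x ⊕ 1) z ≡ false
  ¬arc-⊕1 x {z} z≈x = dec-false (arc? (x ⊕ 1) z) (impossible z≈x)
    where
    impossible : z ≡ x ⊎ z ≡ x ⊕ 1 ⊎ z ≡ x ⊕ (2 * k) → ¬ (AntiHoleAdj N (x ⊕ 1) z × z ⊕ 2 ≢ x ⊕ 1)
    impossible (inj₁ refl)        (adj , _) = ¬adj-⊕1 x (adj-sym adj)
    impossible (inj₂ (inj₁ refl)) (adj , _) = irrefl (antiHole N) adj
    impossible (inj₂ (inj₂ refl)) (_ , ne)  =
      ne (trans (sym (⊕-assoc (x ⊕ (2 * k)) 1 1)) (cong (_⊕ 1) (⊕m⊕1 x)))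

  -- An independent set lies within two consecutive vertices x, x ⊕ 1, and then x ⊕ 1 or
  -- x ⊕ 2 is outside the set with no out-neighbour in it.
  no-kernel : ¬ HasKernel (antiHole N) D
  no-kernel (S , independent , absorbing) = some-member (S zero) refl
    where
    unabsorbed : ∀ x → S x ≡ true → S (x ⊕ 1) ≡ false → ⊥
    unabsorbed x x∈ x⊕1∉ with absorbing (x ⊕ 1) x⊕1∉
    ... | z , z∈ , arc = contradictionᵇ arc (¬arc-⊕1 x (non-neighbour (independent x z x∈ z∈)))
    ⊕2∉ : ∀ x → S x ≡ true → S (x ⊕ 1 ⊕ 1) ≡ false
    ⊕2∉ x x∈ with S (x ⊕ 1 ⊕ 1) in e
    ... | false = refl
    ... | true  = ⊥-elim (independent x (x ⊕ 1 ⊕ 1) x∈ e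
      (subst (AntiHoleAdj N x) (sym (⊕-assoc x 1 1)) (adj-⊕ x (s≤s (s≤s z≤n)) (<⇒≤ 4<N))))
    member : ∀ x → S x ≡ true → ⊥
    member x x∈ with S (x ⊕ 1) in e
    ... | false = unabsorbed x x∈ e
    ... | true  = unabsorbed (x ⊕ 1) e (⊕2∉ x x∈)
    some-member : ∀ b → S zero ≡ b → ⊥
    some-member true  e = member zero e
    some-member false e = member (proj₁ (absorbing zero e)) (proj₁ (proj₂ (absorbing zero e)))

¬kernel-solvable : ∀ k → 2 ≤ k → ¬ KernelSolvable (antiHole (suc (2 * k)))
¬kernel-solvable k 2≤k solvable = no-kernel (solvable D orientation clique-acyclic)
  where open KernelFreeOrientation k 2≤k

proposition1p3 : ∀ (k : ℕ) → 4 ≤ k →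
    SimpleKernelSolvable (antiHole (suc (2 * k))) ×
    ¬ KernelSolvable (antiHole (suc (2 * k)))
proposition1p3 k 4≤k = simple-kernel-solvable k 4≤k , ¬kernel-solvable k (≤-trans (s≤s (s≤s z≤n)) 4≤k)
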